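{- Any algorithm solving all proximate neighbors instances of size $N$ must be capable of producing at least $\frac{(N/2)!}{(B/2)^{N/2}}$ different block permutations.
   Context: Shared memory is partitioned into blocks of $B$ cells. A block permutation describes the content of shared memory as a set of at most $B$ atoms for each block. An instance of the proximate neighbors problem of size $N$ consists of atoms $x_i$, $i\in[N]$, with a labeling function $\lambda:[N]\to[\frac N2]$ such that $|\lambda^{ -1}(i)|=2$ for all $i$. An output block permutation solves the instance if for every $i\in[\frac N2]$ the two atoms with label $i$ are stored in the same block (blocks may contain fewer than $B$ atoms). The claim is that the set of output block permutations produced over all instances has at least the stated size. -}

module Defs where

open import Data.Nat using (ℕ; _≤_; _≟_)
open import Data.Fin using (Fin)
import Data.Fin as F
open import Data.List using (List; length; filter; allFin)
open import Relation.Binary.PropositionalEquality using (_≡_)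

-- Atoms of an instance of size N = 2n are indexed by Fin (2n) (N must be even
-- for a labeling with all fibres of size 2 to exist).

countFin : ∀ {m} → (Fin m → ℕ) → ℕ → ℕ
countFin {m} f b = length (filter (λ i → f i ≟ b) (allFin m))

countLabel : ∀ {m n} → (Fin m → Fin n) → Fin n → ℕ
countLabel {m} λ' j = length (filter (λ i → λ' i F.≟ j) (allFin m))

IsPNInstance : (n : ℕ) → (Fin (2 Data.Nat.* n) → Fin n) → Set
IsPNInstance n λ' = ∀ j → countLabel λ' j ≡ 2

-- A block permutation of atoms [m] into blocks of size B: each atom is stored
-- in a block (indexed by ℕ), and each block holds at most B atoms.
BlockPerm : ℕ → Set
BlockPerm m = Fin m → ℕ

IsBlockPerm : (B : ℕ) → ∀ {m} → BlockPerm m → Set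
IsBlockPerm B P = ∀ b → countFin P b ≤ B

Solves : ∀ {n} → (Fin (2 Data.Nat.* n) → Fin n) → BlockPerm (2 Data.Nat.* n) → Set
Solves λ' P = ∀ i k → λ' i ≡ λ' k → P i ≡ P k

module Submission where

-- Split the 2n atoms into a first half
-- x₀ … x_{n-1} and a second half y₀ … y_{n-1}.  A permutation σ of Fin n gives
-- the instance λ_σ with λ_σ(xᵢ) = σ(i) and λ_σ(yₖ) = k; the n! permutations are
-- enumerated by  permutation n : Fin (n !) → (Fin n → Fin n).  A block
-- permutation Q solving λ_σ puts y_{σ(i)} into the block of xᵢ, so every block
-- holds exactly as many y's as x's and therefore at most B/2 of the y's.  Hence
-- σ is determined by Q together with the "slots" of σ: for every i, the rank
-- of y_{σ(i)} among the y's in the block of xᵢ, a number below B/2.  Sending σ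
-- to (position of its output in L, slots) is thus an injection
-- Fin (n !) → Fin (length L * (B/2)^n), and (B/2)^n * 2^n ≤ B^n concludes.

open import Defs
open import Function using (_∘_; id)
open import Data.Bool using (Bool; true; false)
open import Data.Nat using (ℕ; zero; suc; _+_; _*_; _^_; _≤_; _<_; _!; _/_; s≤s; z≤n)
open import Data.Nat.Properties
  using (+-assoc; +-identityʳ; *-comm; *-assoc; +-cancelˡ-≡; +-monoʳ-<;
         ≤-trans; ≤-reflexive; <-≤-trans; ^-monoˡ-≤; *-monoˡ-≤; *-monoʳ-≤;
         +-commutativeSemigroup; *-commutativeSemigroup; module ≤-Reasoning)
  renaming (_≟_ to _≟ℕ_)
open import Data.Nat.DivMod using (m*n/n≡m; m/n*n≤m; /-monoˡ-≤)
open import Data.Fin as F using (Fin; zero; suc; _↑ˡ_; _↑ʳ_; splitAt; punchIn; combine;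
  quotient; remainder; fromℕ<; funToFin; finToFun)
open import Data.Fin.Properties
  using (splitAt-↑ˡ; splitAt-↑ʳ; punchIn-injective; punchInᵢ≢i; combine-remQuot;
         combine-injective; toℕ-fromℕ<; finToFun-funToFin; injective⇒≤)
open import Data.Sum using ([_,_]′)
open import Data.Empty using (⊥-elim)
open import Data.Product using (_×_; _,_; proj₁; proj₂)
open import Data.List using (List; length; filter; tabulate; lookup)
open import Data.List.Relation.Unary.Any as Any using (Any)
open import Data.List.Relation.Unary.Any.Properties using (lookup-index)
open import Relation.Nullary using (does)
open import Relation.Nullary.Decidable using (dec-true; dec-false)
open import Relation.Unary using (Pred; Decidable)
open import Relation.Binary.PropositionalEquality
  using (_≡_; _≢_; _≗_; refl; sym; trans; cong; cong₂; subst; module ≡-Reasoning)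
open import Algebra.Properties.CommutativeSemigroup +-commutativeSemigroup
  using (x∙yz≈y∙xz)
open import Algebra.Properties.CommutativeSemigroup *-commutativeSemigroup
  using (interchange)

indicator : Bool → ℕ
indicator true  = 1
indicator false = 0

count : ∀ {m} → (Fin m → Bool) → ℕ
count {zero}  p = 0
count {suc m} p = indicator (p zero) + count (p ∘ suc)

count-cong : ∀ {m} {p q : Fin m → Bool} → p ≗ q → count p ≡ count q
count-cong {zero}  p≗q = refl
count-cong {suc m} p≗q = cong₂ _+_ (cong indicator (p≗q zero)) (count-cong (p≗q ∘ suc))

count-none : ∀ {m} (p : Fin m → Bool) → (∀ i → p i ≡ false) → count p ≡ 0
count-none {zero}  p none = refl
count-none {suc m} p none rewrite none zero = count-none (p ∘ suc) (none ∘ suc)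

count-+ : ∀ m {k} (p : Fin (m + k) → Bool) →
          count p ≡ count (p ∘ (_↑ˡ k)) + count (p ∘ (m ↑ʳ_))
count-+ zero    p = refl
count-+ (suc m) p =
  trans (cong (indicator (p zero) +_) (count-+ m (p ∘ suc))) (sym (+-assoc (indicator (p zero)) _ _))

-- Separating one point j: the other points are the image of punchIn j.
count-punchIn : ∀ {m} (p : Fin (suc m) → Bool) j →
                count p ≡ indicator (p j) + count (p ∘ punchIn j)
count-punchIn p zero = refl
count-punchIn {suc m} p (suc j) =
  trans (cong (indicator (p zero) +_) (count-punchIn (p ∘ suc) j))
        (x∙yz≈y∙xz (indicator (p zero)) (indicator (p (suc j))) _)

count-≟ : ∀ {m} (j : Fin m) → count (λ k → does (k F.≟ j)) ≡ 1
count-≟ {suc m} j = begin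
  count (λ k → does (k F.≟ j))
    ≡⟨ count-punchIn (λ k → does (k F.≟ j)) j ⟩
  indicator (does (j F.≟ j)) + count (λ i → does (punchIn j i F.≟ j))
    ≡⟨ cong₂ _+_ (cong indicator (dec-true (j F.≟ j) refl))
                 (count-none _ (λ i → dec-false (punchIn j i F.≟ j) (punchInᵢ≢i j i))) ⟩
  1 ∎
  where open ≡-Reasoning

-- Filtering a tabulated list keeps count-many elements; since allFin m is
-- tabulate id, this links the list-based counts countFin and countLabel to count.
length-filter-tabulate : ∀ {a ℓ} {A : Set a} {P : Pred A ℓ} (P? : Decidable P) {m}
                         (f : Fin m → A) →
                         length (filter P? (tabulate f)) ≡ count (does ∘ P? ∘ f)
length-filter-tabulate P? {zero}  f = refl
length-filter-tabulate P? {suc m} f with does (P? (f zero))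
... | true  = cong suc (length-filter-tabulate P? (f ∘ suc))
... | false = length-filter-tabulate P? (f ∘ suc)

countFin≡count : ∀ {m} (Q : Fin m → ℕ) b → countFin Q b ≡ count (λ x → does (Q x ≟ℕ b))
countFin≡count Q b = length-filter-tabulate (λ x → Q x ≟ℕ b) id

countLabel≡count : ∀ {m n} (λ' : Fin m → Fin n) j →
                   countLabel λ' j ≡ count (λ x → does (λ' x F.≟ j))
countLabel≡count λ' j = length-filter-tabulate (λ x → λ' x F.≟ j) id

rank : ∀ {m} → (Fin m → Bool) → Fin m → ℕ
rank p zero    = 0
rank p (suc k) = indicator (p zero) + rank (p ∘ suc) k

rank<count : ∀ {m} (p : Fin m → Bool) k → p k ≡ true → rank p k < count p
rank<count p zero    pk rewrite pk = s≤s z≤n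
rank<count p (suc k) pk = +-monoʳ-< (indicator (p zero)) (rank<count (p ∘ suc) k pk)

indicator-true+≢0 : ∀ {b} x → b ≡ true → indicator b + x ≢ 0
indicator-true+≢0 x refl ()

rank-injective : ∀ {m} (p : Fin m → Bool) {k k′} → p k ≡ true → p k′ ≡ true →
                 rank p k ≡ rank p k′ → k ≡ k′
rank-injective p {zero}  {zero}   pk pk′ eq = refl
rank-injective p {zero}  {suc k′} pk pk′ eq = ⊥-elim (indicator-true+≢0 _ pk (sym eq))
rank-injective p {suc k} {zero}   pk pk′ eq = ⊥-elim (indicator-true+≢0 _ pk′ eq)
rank-injective p {suc k} {suc k′} pk pk′ eq =
  cong suc (rank-injective (p ∘ suc) pk pk′ (+-cancelˡ-≡ (indicator (p zero)) _ _ eq))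

-- The n! permutations of Fin n, indexed in the factorial number system: an
-- index of Fin (suc n !) = Fin (suc n * n !) is a pair of a leading digit,
-- the image of 0, and the index of the permutation inserted around it.
leading : ∀ n → Fin (suc n !) → Fin (suc n)
leading n = quotient (n !)

rest : ∀ n → Fin (suc n !) → Fin (n !)
rest n = remainder {suc n} (n !)

permutation : ∀ n → Fin (n !) → Fin n → Fin n
permutation (suc n) a zero    = leading n a
permutation (suc n) a (suc i) = punchIn (leading n a) (permutation n (rest n a) i)

permutation-injective : ∀ n {a a′} → permutation n a ≗ permutation n a′ → a ≡ a′
permutation-injective zero    {zero} {zero} same = refl
permutation-injective (suc n) {a}    {a′}   same = begin
  a                                    ≡⟨ combine-remQuot {suc n} (n !) a ⟨
  combine (leading n a) (rest n a)     ≡⟨ cong₂ combine same-leading same-rest ⟩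
  combine (leading n a′) (rest n a′)   ≡⟨ combine-remQuot {suc n} (n !) a′ ⟩
  a′                                   ∎
  where
  open ≡-Reasoning
  same-leading : leading n a ≡ leading n a′
  same-leading = same zero
  same-rest : rest n a ≡ rest n a′
  same-rest = permutation-injective n λ i →
    punchIn-injective (leading n a′) _ _
      (trans (cong (λ j → punchIn j (permutation n (rest n a) i)) (sym same-leading))
             (same (suc i)))

count-permutation : ∀ n a (p : Fin n → Bool) → count (p ∘ permutation n a) ≡ count p
count-permutation zero    a p = refl
count-permutation (suc n) a p = begin
  indicator (p j) + count (p ∘ punchIn j ∘ permutation n (rest n a))
    ≡⟨ cong (indicator (p j) +_) (count-permutation n (rest n a) (p ∘ punchIn j)) ⟩
  indicator (p j) + count (p ∘ punchIn j)
    ≡⟨ count-punchIn p j ⟨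
  count p ∎
  where
  open ≡-Reasoning
  j : Fin (suc n)
  j = leading n a

^-distribʳ-* : ∀ m k e → (m * k) ^ e ≡ m ^ e * k ^ e
^-distribʳ-* m k zero    = refl
^-distribʳ-* m k (suc e) =
  trans (cong (m * k *_) (^-distribʳ-* m k e)) (interchange m k (m ^ e) (k ^ e))

-- Rounding B/2 down loses nothing in the bound: (B/2)^e · 2^e ≤ B^e.
half^e*2^e≤ : ∀ B e → (B / 2) ^ e * 2 ^ e ≤ B ^ e
half^e*2^e≤ B e =
  ≤-trans (≤-reflexive (sym (^-distribʳ-* (B / 2) 2 e))) (^-monoˡ-≤ e (m/n*n≤m B 2))

≤-half : ∀ {c B} → c + c ≤ B → c ≤ B / 2
≤-half {c} {B} c+c≤B = begin
  c          ≡⟨ m*n/n≡m c 2 ⟨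
  c * 2 / 2  ≤⟨ /-monoˡ-≤ 2 (≤-trans (≤-reflexive c*2≡c+c) c+c≤B) ⟩
  B / 2      ∎
  where
  open ≤-Reasoning
  c*2≡c+c : c * 2 ≡ c + c
  c*2≡c+c = trans (*-comm c 2) (cong (c +_) (+-identityʳ c))

module HardInstances (n : ℕ) where

  -- The atoms Fin (2 * n) = Fin (n + (n + 0)): a first half xᵢ, a second half yₖ.
  first second : Fin n → Fin (2 * n)
  first  i = i ↑ˡ (n + 0)
  second k = n ↑ʳ (k ↑ˡ 0)

  count-halves : (p : Fin (2 * n) → Bool) → count p ≡ count (p ∘ first) + count (p ∘ second)
  count-halves p =
    trans (count-+ n p)
          (cong (count (p ∘ first) +_) (trans (count-+ n (p ∘ (n ↑ʳ_))) (+-identityʳ _)))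

  hard : (Fin n → Fin n) → Fin (2 * n) → Fin n
  hard σ x = [ σ , (λ y → [ id , (λ ()) ]′ (splitAt n y)) ]′ (splitAt n x)

  hard-first : ∀ σ i → hard σ (first i) ≡ σ i
  hard-first σ i rewrite splitAt-↑ˡ n i (n + 0) = refl

  hard-second : ∀ σ k → hard σ (second k) ≡ k
  hard-second σ k rewrite splitAt-↑ʳ n (n + 0) (k ↑ˡ 0) | splitAt-↑ˡ n k 0 = refl

  -- For a permutation σ, λ_σ is a proximate neighbours instance: label j is
  -- carried by exactly one xᵢ (namely i = σ⁻¹ j) and by y_j.
  hard-isInstance : ∀ a → IsPNInstance n (hard (permutation n a))
  hard-isInstance a j = begin
    countLabel (hard σ) j
      ≡⟨ countLabel≡count (hard σ) j ⟩
    count (is-j ∘ hard σ)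
      ≡⟨ count-halves (is-j ∘ hard σ) ⟩
    count (is-j ∘ hard σ ∘ first) + count (is-j ∘ hard σ ∘ second)
      ≡⟨ cong₂ _+_ (count-cong (cong is-j ∘ hard-first σ)) (count-cong (cong is-j ∘ hard-second σ)) ⟩
    count (is-j ∘ σ) + count is-j
      ≡⟨ cong (_+ count is-j) (count-permutation n a is-j) ⟩
    count is-j + count is-j
      ≡⟨ cong₂ _+_ (count-≟ j) (count-≟ j) ⟩
    2 ∎
    where
    open ≡-Reasoning
    σ : Fin n → Fin n
    σ = permutation n a
    is-j : Fin n → Bool
    is-j k = does (k F.≟ j)

  Pairs : BlockPerm (2 * n) → (Fin n → Fin n) → Set
  Pairs Q σ = ∀ i → Q (second (σ i)) ≡ Q (first i)

  solution⇒pairs : ∀ {B σ} {P Q : BlockPerm (2 * n)} → P ≗ Q →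
                   IsBlockPerm B Q × Solves (hard σ) Q → IsBlockPerm B P × Pairs P σ
  solution⇒pairs {B} {σ} {P} {Q} P≗Q (fits , solves) = fits′ , pairs
    where
    fits′ : IsBlockPerm B P
    fits′ b = subst (_≤ B) (sym same-count) (fits b)
      where
      same-count : countFin P b ≡ countFin Q b
      same-count = begin
        countFin P b                     ≡⟨ countFin≡count P b ⟩
        count (λ x → does (P x ≟ℕ b))    ≡⟨ count-cong (λ x → cong (λ c → does (c ≟ℕ b)) (P≗Q x)) ⟩
        count (λ x → does (Q x ≟ℕ b))    ≡⟨ countFin≡count Q b ⟨
        countFin Q b                     ∎
        where open ≡-Reasoning
    pairs : Pairs P σ
    pairs i = begin
      P (second (σ i))  ≡⟨ P≗Q (second (σ i)) ⟩
      Q (second (σ i))  ≡⟨ solves _ _ (trans (hard-second σ (σ i)) (sym (hard-first σ i))) ⟩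
      Q (first i)       ≡⟨ P≗Q (first i) ⟨
      P (first i)       ∎
      where open ≡-Reasoning

  inBlock : BlockPerm (2 * n) → ℕ → Fin n → Bool
  inBlock Q b k = does (Q (second k) ≟ℕ b)

  -- Block share: if Q pairs a permutation, each block holds as many y's as
  -- x's, so within capacity B it holds at most B/2 of the y's.
  inBlock≤half : ∀ {B Q} a → IsBlockPerm B Q → Pairs Q (permutation n a) →
                 ∀ b → count (inBlock Q b) ≤ B / 2
  inBlock≤half {B} {Q} a fits pairs b = ≤-half (subst (_≤ B) twice (fits b))
    where
    open ≡-Reasoning
    ys xs : ℕ
    ys = count (inBlock Q b)
    xs = count (λ i → does (Q (first i) ≟ℕ b))
    ys≡xs : ys ≡ xs
    ys≡xs = begin
      ys                                          ≡⟨ count-permutation n a (inBlock Q b) ⟨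
      count (inBlock Q b ∘ permutation n a)       ≡⟨ count-cong (cong (λ c → does (c ≟ℕ b)) ∘ pairs) ⟩
      xs                                          ∎
    twice : countFin Q b ≡ ys + ys
    twice = begin
      countFin Q b                     ≡⟨ countFin≡count Q b ⟩
      count (λ x → does (Q x ≟ℕ b))    ≡⟨ count-halves (λ x → does (Q x ≟ℕ b)) ⟩
      xs + ys                          ≡⟨ cong (_+ ys) ys≡xs ⟨
      ys + ys                          ∎

  slot : BlockPerm (2 * n) → (Fin n → Fin n) → Fin n → ℕ
  slot Q σ i = rank (inBlock Q (Q (first i))) (σ i)

  paired-inBlock : ∀ {Q σ} → Pairs Q σ → ∀ i → inBlock Q (Q (first i)) (σ i) ≡ true
  paired-inBlock pairs i = dec-true (_ ≟ℕ _) (pairs i)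

  slot<half : ∀ {B Q} a → IsBlockPerm B Q → Pairs Q (permutation n a) →
              ∀ i → slot Q (permutation n a) i < B / 2
  slot<half {Q = Q} a fits pairs i =
    <-≤-trans (rank<count (inBlock Q (Q (first i))) _ (paired-inBlock {Q} pairs i))
              (inBlock≤half a fits pairs (Q (first i)))

  slots-determine : ∀ {Q Q′ σ σ′} → Q ≡ Q′ → Pairs Q σ → Pairs Q′ σ′ →
                    (∀ i → slot Q σ i ≡ slot Q′ σ′ i) → σ ≗ σ′
  slots-determine {Q} {σ = σ} {σ′} refl pairs pairs′ same-slots i =
    rank-injective (inBlock Q (Q (first i)))
      (paired-inBlock {Q} {σ} pairs i) (paired-inBlock {Q} {σ′} pairs′ i) (same-slots i)

  -- Encoding bound: if for every permutation index a one of ℓ candidate block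
  -- permutations, out (choice a), fits capacity B and pairs permutation n a,
  -- then a ↦ (choice a, slots) is injective, whence n! ≤ ℓ · (B/2)^n.
  encoding-bound : ∀ {B ℓ} (out : Fin ℓ → BlockPerm (2 * n)) (choice : Fin (n !) → Fin ℓ) →
                   (∀ a → IsBlockPerm B (out (choice a)) × Pairs (out (choice a)) (permutation n a)) →
                   n ! ≤ ℓ * (B / 2) ^ n
  encoding-bound {B} {ℓ} out choice valid = injective⇒≤ encode-injective
    where
    Q : Fin (n !) → BlockPerm (2 * n)
    Q a = out (choice a)

    code : Fin (n !) → Fin n → Fin (B / 2)
    code a i = fromℕ< (slot<half a (proj₁ (valid a)) (proj₂ (valid a)) i)

    encode : Fin (n !) → Fin (ℓ * (B / 2) ^ n)
    encode a = combine (choice a) (funToFin (code a))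

    encode-injective : ∀ {a a′} → encode a ≡ encode a′ → a ≡ a′
    encode-injective {a} {a′} same = permutation-injective n
      (slots-determine (cong out same-choice) (proj₂ (valid a)) (proj₂ (valid a′)) same-slot)
      where
      open ≡-Reasoning
      same-parts : choice a ≡ choice a′ × funToFin (code a) ≡ funToFin (code a′)
      same-parts = combine-injective (choice a) (funToFin (code a)) (choice a′) (funToFin (code a′)) same
      same-choice : choice a ≡ choice a′
      same-choice = proj₁ same-parts
      same-code : ∀ i → code a i ≡ code a′ i
      same-code i = begin
        code a i                        ≡⟨ finToFun-funToFin (code a) i ⟨
        finToFun (funToFin (code a)) i  ≡⟨ cong (λ c → finToFun c i) (proj₂ same-parts) ⟩
        finToFun (funToFin (code a′)) i ≡⟨ finToFun-funToFin (code a′) i ⟩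
        code a′ i                       ∎
      same-slot : ∀ i → slot (Q a) (permutation n a) i ≡ slot (Q a′) (permutation n a′) i
      same-slot i = begin
        slot (Q a) (permutation n a) i    ≡⟨ toℕ-fromℕ< _ ⟨
        F.toℕ (code a i)                  ≡⟨ cong F.toℕ (same-code i) ⟩
        F.toℕ (code a′ i)                 ≡⟨ toℕ-fromℕ< _ ⟩
        slot (Q a′) (permutation n a′) i  ∎

lemma7 : (n B : ℕ)
    → (alg : (λ' : Fin (2 * n) → Fin n) → IsPNInstance n λ' → BlockPerm (2 * n))
    → (∀ λ' (h : IsPNInstance n λ') → IsBlockPerm B (alg λ' h) × Solves λ' (alg λ' h))
    → (L : List (BlockPerm (2 * n)))
    → (∀ λ' (h : IsPNInstance n λ') → Any (λ P → ∀ i → P i ≡ alg λ' h i) L)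
    → (n !) * 2 ^ n ≤ length L * B ^ n
lemma7 n B alg correct L covers = begin
  n ! * 2 ^ n                       ≤⟨ *-monoˡ-≤ (2 ^ n) (encoding-bound (lookup L) choice chosen-valid) ⟩
  length L * (B / 2) ^ n * 2 ^ n    ≡⟨ *-assoc (length L) ((B / 2) ^ n) (2 ^ n) ⟩
  length L * ((B / 2) ^ n * 2 ^ n)  ≤⟨ *-monoʳ-≤ (length L) (half^e*2^e≤ B n) ⟩
  length L * B ^ n                  ∎
  where
  open ≤-Reasoning
  open HardInstances n
  located : ∀ a → Any (λ P → ∀ i → P i ≡ alg (hard (permutation n a)) (hard-isInstance a) i) L
  located a = covers (hard (permutation n a)) (hard-isInstance a)
  choice : Fin (n !) → Fin (length L)
  choice a = Any.index (located a)
  chosen-valid : ∀ a → IsBlockPerm B (lookup L (choice a)) × Pairs (lookup L (choice a)) (permutation n a)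
  chosen-valid a = solution⇒pairs (lookup-index (located a)) (correct _ (hard-isInstance a))
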